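{- If $n\geq 5$ and $n\equiv 1, 3,$ or $7 \pmod 8$, then $K_n^*$ admits a $(\vec{C}_2,\ldots,\vec{C}_2,\vec{C}_3)$-factorization.
   Context: $K_n^*$ denotes the complete symmetric digraph on $n$ vertices (for every ordered pair of distinct vertices $(u,v)$ there is exactly one arc from $u$ to $v$). $\vec{C}_m$ denotes a directed cycle of length $m$ ($\vec{C}_2$ on $u,v$ is the pair of arcs $(u,v),(v,u)$). For odd $n$, a $(\vec{C}_2,\ldots,\vec{C}_2,\vec{C}_3)$-factor of $K_n^*$ is a spanning subdigraph consisting of $(n-3)/2$ directed 2-cycles and one directed 3-cycle, all pairwise vertex-disjoint; a $(\vec{C}_2,\ldots,\vec{C}_2,\vec{C}_3)$-factorization of $K_n^*$ is a partition of its arc set into such factors. -}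

module Defs where

open import Data.Nat using (ℕ)
open import Data.Fin using (Fin; _≟_)
open import Data.Product using (_×_; _,_; Σ)
open import Data.List using (List; []; _∷_; _++_; concatMap; allFin; cartesianProduct; filter)
open import Data.List.Relation.Binary.Permutation.Propositional using (_↭_)
open import Relation.Nullary using (¬?)

Arc : ℕ → Set
Arc n = Fin n × Fin n

arcsK* : (n : ℕ) → List (Arc n)
arcsK* n = filter (λ p → ¬? (Data.Product.proj₁ p ≟ Data.Product.proj₂ p))
                  (cartesianProduct (allFin n) (allFin n))

arcsC2 : {n : ℕ} → Fin n × Fin n → List (Arc n)
arcsC2 (u , v) = (u , v) ∷ (v , u) ∷ []

arcsC3 : {n : ℕ} → Fin n × Fin n × Fin n → List (Arc n)
arcsC3 (a , b , c) = (a , b) ∷ (b , c) ∷ (c , a) ∷ []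

verticesC2 : {n : ℕ} → Fin n × Fin n → List (Fin n)
verticesC2 (u , v) = u ∷ v ∷ []

verticesC3 : {n : ℕ} → Fin n × Fin n × Fin n → List (Fin n)
verticesC3 (a , b , c) = a ∷ b ∷ c ∷ []

-- A (C2,...,C2,C3)-factor of K_n^*: a list of directed 2-cycles and one
-- directed 3-cycle whose vertex lists, concatenated, form a permutation of
-- all vertices (so the cycles are pairwise vertex-disjoint, each cycle has
-- distinct vertices, and the factor is spanning; hence there are exactly
-- (n-3)/2 two-cycles).
record C2C3Factor (n : ℕ) : Set where
  field
    twoCycles   : List (Fin n × Fin n)
    threeCycle  : Fin n × Fin n × Fin n
    spanning    : (concatMap verticesC2 twoCycles ++ verticesC3 threeCycle) ↭ allFin n

open C2C3Factor public

factorArcs : {n : ℕ} → C2C3Factor n → List (Arc n)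
factorArcs F = concatMap arcsC2 (twoCycles F) ++ arcsC3 (threeCycle F)

-- A (C2,...,C2,C3)-factorization of K_n^*: a list of such factors whose arc
-- sets partition the arc set of K_n^* (every arc lies in exactly one factor).
C2C3Factorization : ℕ → Set
C2C3Factorization n =
  Σ (List (C2C3Factor n)) (λ Fs → concatMap factorArcs Fs ↭ arcsK* n)

-- Write n = 2m + 1 and take as vertices ∞ together with two copies ℤ_m × {0, 1}.  Translating
-- a base factor through ℤ_m gives m factors, so two base factors give 2m factors with
-- 2m · n = n(n - 1) arcs in total, and by counting it suffices that every arc of K_n^* occurs.
-- The translates of an arc realise every arc with the same levels at its ends and the same
-- difference of residues, so the two base factors must together contain an arc of every such
-- difference, and arcs from ∞ to each level and back.  For m odd (n ≡ 3 mod 4) the pairs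
-- {x, -x} within each copy give every same-level difference, because 2 is invertible modulo m,
-- and the pairs x₀, (2x)₁ every mixed one; for m = 4q (n ≡ 1 mod 8) the two base factors are
-- built from four families of pairs instead.
module Submission where

open import Defs
open import Data.Bool using (Bool; true; false)
open import Data.Empty using (⊥-elim)
open import Data.Fin using (Fin; toℕ; fromℕ; fromℕ<; _≟_)
open import Data.Fin.Properties using (toℕ-injective; toℕ-fromℕ<; toℕ-fromℕ; toℕ<n)
open import Data.List using (List; []; _∷_; _++_; concatMap; allFin; cartesianProduct; filter; length; map; upTo)
open import Data.List.Membership.Propositional using (_∈_)
open import Data.List.Membership.Propositional.Properties
  using (∈-∃++; ∈-++⁻; ∈-++⁺ˡ; ∈-++⁺ʳ; ∈-map⁺; ∈-upTo⁺; ∈-allFin; ∈-concat⁺′; ∈-filter⁻)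
open import Data.List.Properties
  using ( length-++; length-map; length-upTo; length-tabulate; concatMap-map; map-concatMap; map-++
        ; filter-++; filter-accept; filter-reject; filter-all)
open import Data.List.Relation.Binary.Permutation.Propositional using (_↭_; ↭-refl; ↭-trans; prep)
open import Data.List.Relation.Binary.Permutation.Propositional.Properties using (shift; ↭-length)
open import Data.List.Relation.Binary.Subset.Propositional using (_⊆_)
open import Data.List.Relation.Unary.All using (All; []; _∷_; lookup)
open import Data.List.Relation.Unary.Any using (here; there)
open import Data.List.Relation.Unary.Unique.Propositional using (Unique; []; _∷_)
import Data.List.Relation.Unary.Unique.Propositional.Properties as Unique
open import Data.Nat using (ℕ; zero; suc; _+_; _*_; _∸_; _≤_; _<_; _%_; _/_; z≤n; s≤s; s≤s⁻¹)
open import Data.Nat.DivMod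
  using (m%n<n; [m+n]%n≡m%n; [m+kn]%n≡m%n; %-distribˡ-+; m%n%n≡m%n; m<n⇒m%n≡m; m≡m%n+[m/n]*n)
open import Data.Nat.Properties hiding (_≟_)
open import Algebra.Properties.CommutativeSemigroup +-commutativeSemigroup using (x∙yz≈y∙xz; xy∙z≈xz∙y)
open import Data.Nat.Tactic.RingSolver using (solve-∀)
open import Data.Product using (_×_; _,_; Σ; proj₁; proj₂)
open import Data.Sum using (_⊎_; inj₁; inj₂)
open import Function using (_∘_)
open import Relation.Binary.Bundles using (Setoid)
import Relation.Binary.Reasoning.Setoid as SetoidReasoning
open import Relation.Binary.PropositionalEquality
open import Relation.Nullary using (¬_; Dec; yes; no; ¬?)

∈-concatMap⁺′ : ∀ {A B : Set} {f : A → List B} {x xs y} → x ∈ xs → y ∈ f x → y ∈ concatMap f xs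
∈-concatMap⁺′ {f = f} x∈xs y∈fx = ∈-concat⁺′ y∈fx (∈-map⁺ f x∈xs)

length-concatMap-const : ∀ {A B : Set} (f : A → List B) {c} → (∀ x → length (f x) ≡ c) →
                         ∀ xs → length (concatMap f xs) ≡ length xs * c
length-concatMap-const f fc [] = refl
length-concatMap-const f fc (x ∷ xs) = trans (length-++ (f x)) (cong₂ _+_ (fc x) (length-concatMap-const f fc xs))

⊆∧length≤⇒↭ : ∀ {A : Set} {xs ys : List A} → Unique ys → ys ⊆ xs → length xs ≤ length ys → xs ↭ ys
⊆∧length≤⇒↭ {xs = []}    {[]}    _ _ _ = ↭-refl
⊆∧length≤⇒↭ {xs = _ ∷ _} {[]}    _ _ ()
⊆∧length≤⇒↭ {xs = xs}    {y ∷ ys} (y∉ys ∷ ys!) ys⊆xs len≤ with ∈-∃++ (ys⊆xs (here refl))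
... | as , bs , refl = ↭-trans (shift y as bs) (prep y (⊆∧length≤⇒↭ ys! ys⊆as++bs len′≤))
  where
  ys⊆as++bs : ys ⊆ as ++ bs
  ys⊆as++bs z∈ys with ∈-++⁻ as (ys⊆xs (there z∈ys))
  ... | inj₁ z∈as          = ∈-++⁺ˡ z∈as
  ... | inj₂ (here refl)   = ⊥-elim (lookup y∉ys z∈ys refl)
  ... | inj₂ (there z∈bs)  = ∈-++⁺ʳ as z∈bs
  len′≤ : length (as ++ bs) ≤ length ys
  len′≤ = s≤s⁻¹ (subst (_≤ suc (length ys)) (↭-length (shift y as bs)) len≤)

distinct? : ∀ {n} (p : Arc n) → Dec (¬ proj₁ p ≡ proj₂ p)
distinct? p = ¬? (proj₁ p ≟ proj₂ p)

length-filter-distinct-row : ∀ {n} (u : Fin n) (vs : List (Fin n)) → Unique vs → u ∈ vs →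
                             suc (length (filter distinct? (map (u ,_) vs))) ≡ length vs
length-filter-distinct-row u (v ∷ vs) (v∉vs ∷ _) (here refl) =
  cong suc (trans (cong length (trans (filter-reject distinct? {x = u , u} (λ u≢u → u≢u refl))
                                     (filter-all distinct? (row-distinct vs v∉vs))))
                  (length-map (u ,_) vs))
  where
  row-distinct : ∀ ws → All (λ w → ¬ u ≡ w) ws → All (λ p → ¬ proj₁ p ≡ proj₂ p) (map (u ,_) ws)
  row-distinct [] [] = []
  row-distinct (w ∷ ws) (u≢w ∷ u≢ws) = u≢w ∷ row-distinct ws u≢ws
length-filter-distinct-row u (v ∷ vs) (v∉vs ∷ vs!) (there u∈vs) =
  trans (cong (λ l → suc (length l)) (filter-accept distinct? {x = u , v} u≢v))
        (cong suc (length-filter-distinct-row u vs vs! u∈vs))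
  where
  u≢v : ¬ u ≡ v
  u≢v refl = lookup v∉vs u∈vs refl

length-filter-distinct-cartesianProduct : ∀ {n} (us vs : List (Fin n)) → Unique vs → us ⊆ vs →
  length (filter distinct? (cartesianProduct us vs)) ≡ length us * (length vs ∸ 1)
length-filter-distinct-cartesianProduct [] vs vs! us⊆vs = refl
length-filter-distinct-cartesianProduct (u ∷ us) vs vs! us⊆vs = begin
  length (filter distinct? (map (u ,_) vs ++ cartesianProduct us vs))
    ≡⟨ cong length (filter-++ distinct? (map (u ,_) vs) (cartesianProduct us vs)) ⟩
  length (filter distinct? (map (u ,_) vs) ++ filter distinct? (cartesianProduct us vs))
    ≡⟨ length-++ (filter distinct? (map (u ,_) vs)) ⟩
  length (filter distinct? (map (u ,_) vs)) + length (filter distinct? (cartesianProduct us vs))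
    ≡⟨ cong₂ _+_ (cong (_∸ 1) (length-filter-distinct-row u vs vs! (us⊆vs (here refl))))
                 (length-filter-distinct-cartesianProduct us vs vs! (us⊆vs ∘ there)) ⟩
  (length vs ∸ 1) + length us * (length vs ∸ 1) ∎
  where
  open ≡-Reasoning

length-allFin : ∀ n → length (allFin n) ≡ n
length-allFin n = length-tabulate {n = n} (λ i → i)

length-arcsK* : ∀ n → length (arcsK* n) ≡ n * (n ∸ 1)
length-arcsK* n =
  trans (length-filter-distinct-cartesianProduct (allFin n) (allFin n) (Unique.allFin⁺ n) (λ {i} _ → ∈-allFin i))
        (cong₂ (λ a b → a * (b ∸ 1)) (length-allFin n) (length-allFin n))

unique-arcsK* : ∀ n → Unique (arcsK* n)
unique-arcsK* n = Unique.filter⁺ distinct? (Unique.cartesianProduct⁺ (Unique.allFin⁺ n) (Unique.allFin⁺ n))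

-- The vertex pt x l stands for the element x (mod m) of the copy l of ℤ_m; the remaining vertex is ∞.
data Point : Set where
  ∞  : Point
  pt : ℕ → Bool → Point

record Base : Set where
  field
    pairs    : List (Point × Point)
    triangle : Point × Point × Point
open Base public

pairPoints : Point × Point → List Point
pairPoints (P , Q) = P ∷ Q ∷ []

pairArcs : Point × Point → List (Point × Point)
pairArcs (P , Q) = (P , Q) ∷ (Q , P) ∷ []

trianglePoints : Point × Point × Point → List Point
trianglePoints (a , b , c) = a ∷ b ∷ c ∷ []

triangleArcs : Point × Point × Point → List (Point × Point)
triangleArcs (a , b , c) = (a , b) ∷ (b , c) ∷ (c , a) ∷ []

basePoints : Base → List Point
basePoints B = concatMap pairPoints (pairs B) ++ trianglePoints (triangle B)

baseArcs : Base → List (Point × Point)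
baseArcs B = concatMap pairArcs (pairs B) ++ triangleArcs (triangle B)

module _ {B : Base} {P Q : Point} (PQ∈B : (P , Q) ∈ pairs B) where

  pair-arc : (P , Q) ∈ baseArcs B
  pair-arc = ∈-++⁺ˡ (∈-concatMap⁺′ PQ∈B (here refl))

  pair-arc-reversed : (Q , P) ∈ baseArcs B
  pair-arc-reversed = ∈-++⁺ˡ (∈-concatMap⁺′ PQ∈B (there (here refl)))

  pair-point₁ : P ∈ basePoints B
  pair-point₁ = ∈-++⁺ˡ (∈-concatMap⁺′ PQ∈B (here refl))

  pair-point₂ : Q ∈ basePoints B
  pair-point₂ = ∈-++⁺ˡ (∈-concatMap⁺′ PQ∈B (there (here refl)))

module _ (B : Base) {a b c : Point} (abc : triangle B ≡ (a , b , c)) where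

  triangle-arc₁₂ : (a , b) ∈ baseArcs B
  triangle-arc₁₂ rewrite abc = ∈-++⁺ʳ (concatMap pairArcs (pairs B)) (here refl)

  triangle-arc₂₃ : (b , c) ∈ baseArcs B
  triangle-arc₂₃ rewrite abc = ∈-++⁺ʳ (concatMap pairArcs (pairs B)) (there (here refl))

  triangle-arc₃₁ : (c , a) ∈ baseArcs B
  triangle-arc₃₁ rewrite abc = ∈-++⁺ʳ (concatMap pairArcs (pairs B)) (there (there (here refl)))

  triangle-point₁ : a ∈ basePoints B
  triangle-point₁ rewrite abc = ∈-++⁺ʳ (concatMap pairPoints (pairs B)) (here refl)

  triangle-point₂ : b ∈ basePoints B
  triangle-point₂ rewrite abc = ∈-++⁺ʳ (concatMap pairPoints (pairs B)) (there (here refl))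

  triangle-point₃ : c ∈ basePoints B
  triangle-point₃ rewrite abc = ∈-++⁺ʳ (concatMap pairPoints (pairs B)) (there (there (here refl)))

length-factorArcs : ∀ {n} (F : C2C3Factor n) → length (factorArcs F) ≡ n
length-factorArcs {n} F = begin
  length (factorArcs F)
    ≡⟨ length-++ (concatMap arcsC2 cs) ⟩
  length (concatMap arcsC2 cs) + 3
    ≡⟨ cong (_+ 3) (trans (length-concatMap-const arcsC2 (λ _ → refl) cs)
                          (sym (length-concatMap-const verticesC2 (λ _ → refl) cs))) ⟩
  length (concatMap verticesC2 cs) + 3
    ≡⟨ length-++ (concatMap verticesC2 cs) ⟨
  length (concatMap verticesC2 cs ++ verticesC3 (threeCycle F))
    ≡⟨ ↭-length (spanning F) ⟩
  length (allFin n)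
    ≡⟨ length-allFin n ⟩
  n ∎
  where
  open ≡-Reasoning
  cs = twoCycles F

module CyclicDevelopment (m′ : ℕ) where

  m : ℕ
  m = suc m′

  N : ℕ
  N = suc (m + m)

  -- A record rather than a synonym, so that a and b can be inferred from a proof.
  infix 4 _≡ₘ_
  record _≡ₘ_ (a b : ℕ) : Set where
    constructor mod-eq
    field mod-eq⁻ : a % m ≡ b % m

  ≡ₘ-setoid : Setoid _ _
  ≡ₘ-setoid = record
    { Carrier       = ℕ
    ; _≈_           = _≡ₘ_
    ; isEquivalence = record
      { refl  = mod-eq refl
      ; sym   = λ (mod-eq a≡b) → mod-eq (sym a≡b)
      ; trans = λ (mod-eq a≡b) (mod-eq b≡c) → mod-eq (trans a≡b b≡c)
      }
    }

  open Setoid ≡ₘ-setoid public using () renaming (sym to ≡ₘ-sym; trans to ≡ₘ-trans; reflexive to ≡⇒≡ₘ)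

  a+m≡ₘa : ∀ a → a + m ≡ₘ a
  a+m≡ₘa a = mod-eq ([m+n]%n≡m%n a m)

  a+k*m≡ₘa : ∀ a k → a + k * m ≡ₘ a
  a+k*m≡ₘa a k = mod-eq ([m+kn]%n≡m%n a k m)

  a≡b+m⇒a≡ₘb : ∀ {a b} → a ≡ b + m → a ≡ₘ b
  a≡b+m⇒a≡ₘb {b = b} a≡b+m = ≡ₘ-trans (≡⇒≡ₘ a≡b+m) (a+m≡ₘa b)

  a≡b+k*m⇒a≡ₘb : ∀ {a b} k → a ≡ b + k * m → a ≡ₘ b
  a≡b+k*m⇒a≡ₘb {b = b} k a≡b+km = ≡ₘ-trans (≡⇒≡ₘ a≡b+km) (a+k*m≡ₘa b k)

  a%m≡ₘa : ∀ a → a % m ≡ₘ a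
  a%m≡ₘa a = mod-eq (m%n%n≡m%n a m)

  +-congˡ-≡ₘ : ∀ c {a b} → a ≡ₘ b → c + a ≡ₘ c + b
  +-congˡ-≡ₘ c {a} {b} (mod-eq a≡b) = mod-eq (begin
    (c + a) % m             ≡⟨ %-distribˡ-+ c a m ⟩
    (c % m + a % m) % m     ≡⟨ cong (λ r → (c % m + r) % m) a≡b ⟩
    (c % m + b % m) % m     ≡⟨ %-distribˡ-+ c b m ⟨
    (c + b) % m             ∎)
    where open ≡-Reasoning

  +-congʳ-≡ₘ : ∀ c {a b} → a ≡ₘ b → a + c ≡ₘ b + c
  +-congʳ-≡ₘ c {a} {b} a≡b = subst₂ _≡ₘ_ (+-comm c a) (+-comm c b) (+-congˡ-≡ₘ c a≡b)

  ≡ₘ⇒≡ : ∀ {a b} → a < m → b < m → a ≡ₘ b → a ≡ b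
  ≡ₘ⇒≡ a<m b<m (mod-eq a≡b) = trans (sym (m<n⇒m%n≡m a<m)) (trans a≡b (m<n⇒m%n≡m b<m))

  m∸a+[a+a]≡ₘa : ∀ {a} → a ≤ m → (m ∸ a) + (a + a) ≡ₘ a
  m∸a+[a+a]≡ₘa {a} a≤m = begin
    (m ∸ a) + (a + a)  ≡⟨ +-assoc (m ∸ a) a a ⟨
    (m ∸ a + a) + a    ≡⟨ cong (_+ a) (m∸n+n≡m a≤m) ⟩
    m + a              ≡⟨ +-comm m a ⟩
    a + m              ≈⟨ a+m≡ₘa a ⟩
    a                  ∎
    where open SetoidReasoning ≡ₘ-setoid

  -- A representative of y - x (mod m) that avoids truncated subtraction.
  offset : ℕ → ℕ → ℕ
  offset x y = y + (m ∸ x % m)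

  +-offset : ∀ x y → x + offset x y ≡ₘ y
  +-offset x y = begin
    x + (y + (m ∸ x % m))      ≈⟨ +-congʳ-≡ₘ _ (a%m≡ₘa x) ⟨
    x % m + (y + (m ∸ x % m))  ≡⟨ x∙yz≈y∙xz (x % m) y _ ⟩
    y + (x % m + (m ∸ x % m))  ≡⟨ cong (y +_) (m+[n∸m]≡n (<⇒≤ (m%n<n x m))) ⟩
    y + m                      ≈⟨ a+m≡ₘa y ⟩
    y                          ∎
    where open SetoidReasoning ≡ₘ-setoid

  levelShift : Bool → ℕ
  levelShift false = 0
  levelShift true  = m

  vertex< : ∀ x l → x % m + levelShift l < N
  vertex< x false = ≤-trans (+-monoˡ-< 0 (m%n<n x m))
                            (≤-trans (≤-reflexive (+-identityʳ m)) (≤-trans (m≤m+n m m) (n≤1+n _)))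
  vertex< x true  = s≤s (+-monoˡ-≤ m (<⇒≤ (m%n<n x m)))

  vertex : ℕ → Bool → Fin N
  vertex x l = fromℕ< (vertex< x l)

  vertex∞ : Fin N
  vertex∞ = fromℕ (m + m)

  toℕ-vertex : ∀ x l → toℕ (vertex x l) ≡ x % m + levelShift l
  toℕ-vertex x l = toℕ-fromℕ< (vertex< x l)

  vertex-cong : ∀ {x y} l → x ≡ₘ y → vertex x l ≡ vertex y l
  vertex-cong {x} {y} l (mod-eq x≡y) =
    toℕ-injective (trans (toℕ-vertex x l) (trans (cong (_+ levelShift l) x≡y) (sym (toℕ-vertex y l))))

  data VertexView : Fin N → Set where
    at-∞ : VertexView vertex∞
    at   : ∀ x l → x < m → VertexView (vertex x l)

  vertexView : ∀ u → VertexView u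
  vertexView u with toℕ u <? m
  ... | yes u<m = subst VertexView (toℕ-injective (begin
          toℕ (vertex (toℕ u) false) ≡⟨ toℕ-vertex (toℕ u) false ⟩
          toℕ u % m + 0              ≡⟨ +-identityʳ _ ⟩
          toℕ u % m                  ≡⟨ m<n⇒m%n≡m u<m ⟩
          toℕ u                      ∎)) (at (toℕ u) false u<m)
    where open ≡-Reasoning
  ... | no u≮m with toℕ u <? m + m
  ...   | yes u<2m = subst VertexView (toℕ-injective (begin
          toℕ (vertex x true) ≡⟨ toℕ-vertex x true ⟩
          x % m + m           ≡⟨ cong (_+ m) (m<n⇒m%n≡m x<m) ⟩
          x + m               ≡⟨ m∸n+n≡m (≮⇒≥ u≮m) ⟩
          toℕ u               ∎)) (at x true x<m)
    where
    open ≡-Reasoning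
    x = toℕ u ∸ m
    x<m : x < m
    x<m = +-cancelʳ-< _ _ m (subst (_< m + m) (sym (m∸n+n≡m (≮⇒≥ u≮m))) u<2m)
  ...   | no u≮2m = subst VertexView (toℕ-injective (begin
          toℕ vertex∞ ≡⟨ toℕ-fromℕ (m + m) ⟩
          m + m       ≡⟨ ≤-antisym (≮⇒≥ u≮2m) (s≤s⁻¹ (toℕ<n u)) ⟩
          toℕ u       ∎)) at-∞
    where open ≡-Reasoning

  ⟦_⟧ : Point → Fin N
  ⟦ ∞ ⟧      = vertex∞
  ⟦ pt x l ⟧ = vertex x l

  translate : ℕ → Point → Point
  translate s ∞        = ∞
  translate s (pt x l) = pt (x + s) l

  place : ℕ → Point → Fin N
  place s P = ⟦ translate s P ⟧

  placeArc : ℕ → Point × Point → Fin N × Fin N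
  placeArc s (P , Q) = place s P , place s Q

  placeTriangle : ℕ → Point × Point × Point → Fin N × Fin N × Fin N
  placeTriangle s (a , b , c) = place s a , place s b , place s c

  place-% : ∀ s P → place (s % m) P ≡ place s P
  place-% s ∞        = refl
  place-% s (pt x l) = vertex-cong l (+-congˡ-≡ₘ x (a%m≡ₘa s))

  placed-points : ∀ s B →
    concatMap verticesC2 (map (placeArc s) (pairs B)) ++ verticesC3 (placeTriangle s (triangle B))
      ≡ map (place s) (basePoints B)
  placed-points s B =
    trans (cong (_++ verticesC3 (placeTriangle s (triangle B))) (trans (concatMap-map verticesC2 (placeArc s) (pairs B))
                               (sym (map-concatMap (place s) pairPoints (pairs B)))))
          (sym (map-++ (place s) (concatMap pairPoints (pairs B)) (trianglePoints (triangle B))))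

  placed-arcs : ∀ s B →
    concatMap arcsC2 (map (placeArc s) (pairs B)) ++ arcsC3 (placeTriangle s (triangle B))
      ≡ map (placeArc s) (baseArcs B)
  placed-arcs s B =
    trans (cong (_++ arcsC3 (placeTriangle s (triangle B))) (trans (concatMap-map arcsC2 (placeArc s) (pairs B))
                               (sym (map-concatMap (placeArc s) pairArcs (pairs B)))))
          (sym (map-++ (placeArc s) (concatMap pairArcs (pairs B)) (triangleArcs (triangle B))))

  record IsSpanning (B : Base) : Set where
    field
      pair-count     : length (pairs B) ≡ m′
      every-residue  : ∀ l z → z < m → Σ ℕ λ a → pt a l ∈ basePoints B × a ≡ₘ z
      ∞-point        : ∞ ∈ basePoints B
  open IsSpanning public

  length-basePoints : ∀ {B} → IsSpanning B → length (basePoints B) ≡ N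
  length-basePoints {B} B-spans = begin
    length (basePoints B)
      ≡⟨ length-++ (concatMap pairPoints (pairs B)) ⟩
    length (concatMap pairPoints (pairs B)) + 3
      ≡⟨ cong (_+ 3) (length-concatMap-const pairPoints (λ _ → refl) (pairs B)) ⟩
    length (pairs B) * 2 + 3
      ≡⟨ cong (λ k → k * 2 + 3) (pair-count B-spans) ⟩
    m′ * 2 + 3
      ≡⟨ k*2+3≡2[k+1]+1 m′ ⟩
    N ∎
    where
    open ≡-Reasoning
    k*2+3≡2[k+1]+1 : ∀ k → k * 2 + 3 ≡ suc (suc k + suc k)
    k*2+3≡2[k+1]+1 = solve-∀

  developedFactor : (B : Base) → IsSpanning B → ℕ → C2C3Factor N
  developedFactor B B-spans s = record
    { twoCycles  = map (placeArc s) (pairs B)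
    ; threeCycle = placeTriangle s (triangle B)
    ; spanning   = subst (_↭ allFin N) (sym (placed-points s B))
                         (⊆∧length≤⇒↭ (Unique.allFin⁺ N) all⊆placed length≤)
    }
    where
    all⊆placed : allFin N ⊆ map (place s) (basePoints B)
    all⊆placed {u} _ with vertexView u
    ... | at-∞ = ∈-map⁺ (place s) (∞-point B-spans)
    ... | at x l _ with every-residue B-spans l (offset s x % m) (m%n<n (offset s x) m)
    ...   | a , a∈B , a≡ = subst (_∈ map (place s) (basePoints B)) (vertex-cong l a+s≡x) (∈-map⁺ (place s) a∈B)
      where
      a+s≡x : a + s ≡ₘ x
      a+s≡x = begin
        a + s              ≈⟨ +-congʳ-≡ₘ s (≡ₘ-trans a≡ (a%m≡ₘa _)) ⟩
        offset s x + s     ≡⟨ +-comm (offset s x) s ⟩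
        s + offset s x     ≈⟨ +-offset s x ⟩
        x                  ∎
        where open SetoidReasoning ≡ₘ-setoid
    length≤ : length (map (place s) (basePoints B)) ≤ length (allFin N)
    length≤ = ≤-reflexive (trans (length-map (place s) (basePoints B))
                                 (trans (length-basePoints B-spans) (sym (length-allFin N))))

  DifferenceCovered : (Bool → Base) → Bool → Bool → ℕ → Set
  DifferenceCovered base l l′ d =
    Σ Bool λ b → Σ ℕ λ a → Σ ℕ λ a′ → (pt a l , pt a′ l′) ∈ baseArcs (base b) × a′ ≡ₘ a + d

  record DifferenceFamily : Set where
    field
      base        : Bool → Base
      spans       : ∀ b → IsSpanning (base b)
      differences : ∀ l l′ d → d < m → (l ≡ l′ → ¬ d ≡ 0) → DifferenceCovered base l l′ d
      from-∞      : ∀ l → Σ Bool λ b → Σ ℕ λ a → (∞ , pt a l) ∈ baseArcs (base b)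
      to-∞        : ∀ l → Σ Bool λ b → Σ ℕ λ a → (pt a l , ∞) ∈ baseArcs (base b)

  residue-difference : ℕ → ℕ → ℕ
  residue-difference x y = offset x y % m

  +-residue-difference : ∀ x y → x + residue-difference x y ≡ₘ y
  +-residue-difference x y = ≡ₘ-trans (+-congˡ-≡ₘ x (a%m≡ₘa (offset x y))) (+-offset x y)

  residue-difference≢0 : ∀ {x y l} → x < m → y < m → ¬ vertex x l ≡ vertex y l →
                         ¬ residue-difference x y ≡ 0
  residue-difference≢0 {x} {y} {l} x<m y<m x≢y d≡0 = x≢y (cong (λ z → vertex z l) (≡ₘ⇒≡ x<m y<m x≡y))
    where
    x≡y : x ≡ₘ y
    x≡y = subst (_≡ₘ y) (trans (cong (x +_) d≡0) (+-identityʳ x)) (+-residue-difference x y)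

  module _ (D : DifferenceFamily) where
    open DifferenceFamily D

    factor : Bool → ℕ → C2C3Factor N
    factor b = developedFactor (base b) (spans b)

    translates : ℕ → List (C2C3Factor N)
    translates s = factor false s ∷ factor true s ∷ []

    factors : List (C2C3Factor N)
    factors = concatMap translates (upTo m)

    allArcs : List (Arc N)
    allArcs = concatMap factorArcs factors

    placed-arc∈allArcs : ∀ b s {P Q} → (P , Q) ∈ baseArcs (base b) → (place s P , place s Q) ∈ allArcs
    placed-arc∈allArcs b s {P} {Q} PQ∈B =
      subst (_∈ allArcs) (cong₂ _,_ (place-% s P) (place-% s Q))
        (∈-concatMap⁺′ {f = factorArcs} (∈-concatMap⁺′ {f = translates} (∈-upTo⁺ (m%n<n s m)) (factor∈translates b))
                       (subst (placeArc (s % m) (P , Q) ∈_) (sym (placed-arcs (s % m) (base b)))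
                              (∈-map⁺ (placeArc (s % m)) PQ∈B)))
      where
      factor∈translates : ∀ b → factor b (s % m) ∈ translates (s % m)
      factor∈translates false = here refl
      factor∈translates true  = there (here refl)

    length-allArcs : length allArcs ≡ length (arcsK* N)
    length-allArcs = begin
      length allArcs                    ≡⟨ length-concatMap-const factorArcs length-factorArcs factors ⟩
      length factors * N                ≡⟨ cong (_* N) (length-concatMap-const translates (λ _ → refl) (upTo m)) ⟩
      length (upTo m) * 2 * N           ≡⟨ cong (λ k → k * 2 * N) (length-upTo m) ⟩
      m * 2 * N                         ≡⟨ k*2*[2k+1]≡[2k+1]*2k m ⟩
      N * (N ∸ 1)                       ≡⟨ length-arcsK* N ⟨
      length (arcsK* N)                 ∎
      where
      open ≡-Reasoning
      k*2*[2k+1]≡[2k+1]*2k : ∀ k → k * 2 * suc (k + k) ≡ suc (k + k) * (k + k)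
      k*2*[2k+1]≡[2k+1]*2k = solve-∀

    from-∞-arc : ∀ y l → (vertex∞ , vertex y l) ∈ allArcs
    from-∞-arc y l with from-∞ l
    ... | b , a , ∞a∈B = subst (λ v → (vertex∞ , v) ∈ allArcs) (vertex-cong l (+-offset a y))
                               (placed-arc∈allArcs b (offset a y) ∞a∈B)

    to-∞-arc : ∀ x l → (vertex x l , vertex∞) ∈ allArcs
    to-∞-arc x l with to-∞ l
    ... | b , a , a∞∈B = subst (λ u → (u , vertex∞) ∈ allArcs) (vertex-cong l (+-offset a x))
                               (placed-arc∈allArcs b (offset a x) a∞∈B)

    finite-arc : ∀ {x y l l′} → x < m → y < m → ¬ vertex x l ≡ vertex y l′ →
                 (vertex x l , vertex y l′) ∈ allArcs
    finite-arc {x} {y} {l} {l′} x<m y<m x≢y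
      with differences l l′ (residue-difference x y) (m%n<n (offset x y) m)
                       (λ { refl → residue-difference≢0 x<m y<m x≢y })
    ... | b , a , a′ , aa′∈B , a′≡a+d =
      subst₂ (λ u v → (u , v) ∈ allArcs) (vertex-cong l (+-offset a x)) (vertex-cong l′ a′+t≡y)
             (placed-arc∈allArcs b (offset a x) aa′∈B)
      where
      t = offset a x
      d = residue-difference x y
      a′+t≡y : a′ + t ≡ₘ y
      a′+t≡y = begin
        a′ + t       ≈⟨ +-congʳ-≡ₘ t a′≡a+d ⟩
        a + d + t    ≡⟨ xy∙z≈xz∙y a d t ⟩
        a + t + d    ≈⟨ +-congʳ-≡ₘ d (+-offset a x) ⟩
        x + d        ≈⟨ +-residue-difference x y ⟩
        y            ∎
        where open SetoidReasoning ≡ₘ-setoid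

    arc∈allArcs : ∀ {u v} → VertexView u → VertexView v → ¬ u ≡ v → (u , v) ∈ allArcs
    arc∈allArcs at-∞            at-∞            ∞≢∞ = ⊥-elim (∞≢∞ refl)
    arc∈allArcs at-∞            (at y l _)      _   = from-∞-arc y l
    arc∈allArcs (at x l _)      at-∞            _   = to-∞-arc x l
    arc∈allArcs (at x l x<m)    (at y l′ y<m)   x≢y = finite-arc x<m y<m x≢y

    arcsK*⊆allArcs : arcsK* N ⊆ allArcs
    arcsK*⊆allArcs {u , v} uv∈ =
      arc∈allArcs (vertexView u) (vertexView v)
                  (proj₂ (∈-filter⁻ distinct? {xs = cartesianProduct (allFin N) (allFin N)} uv∈))

    developedFactorization : C2C3Factorization N
    developedFactorization =
      factors , ⊆∧length≤⇒↭ (unique-arcsK* N) arcsK*⊆allArcs (≤-reflexive length-allArcs)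

data Parity : ℕ → Set where
  even : ∀ h → Parity (h + h)
  odd  : ∀ h → Parity (suc (h + h))

parity : ∀ n → Parity n
parity zero = even 0
parity (suc n) with parity n
... | even h = odd h
... | odd h  = subst Parity (cong suc (+-suc h h)) (even (suc h))

h+h<k+k⇒h<k : ∀ {h k} → h + h < k + k → h < k
h+h<k+k⇒h<k {h} {k} h+h<k+k with h <? k
... | yes h<k = h<k
... | no  h≮k = ⊥-elim (<⇒≱ h+h<k+k (+-mono-≤ (≮⇒≥ h≮k) (≮⇒≥ h≮k)))

a≡c+b⇒a∸b≡c : ∀ {a b c} → a ≡ c + b → a ∸ b ≡ c
a≡c+b⇒a∸b≡c {b = b} {c} refl = m+n∸n≡m c b

1+c+k≡a⇒a∸[1+k]≡c : ∀ {a c k} → suc (c + k) ≡ a → a ∸ suc k ≡ c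
1+c+k≡a⇒a∸[1+k]≡c {c = c} {k} 1+c+k≡a = a≡c+b⇒a∸b≡c (sym (trans (+-suc c k) 1+c+k≡a))

m+n≡o+p∧o<m⇒n<p : ∀ {m n o p} → m + n ≡ o + p → o < m → n < p
m+n≡o+p∧o<m⇒n<p {m} {n} {o} {p} m+n≡o+p o<m =
  +-cancelˡ-< o n p (≤-trans (+-monoˡ-≤ n o<m) (≤-reflexive m+n≡o+p))

+-cancelʳ-via : ∀ {d q X Y Z} → d + q ≡ Z → X + Z ≡ Y + q → X + d ≡ Y
+-cancelʳ-via {d} {q} {X} {Y} {Z} d+q≡Z X+Z≡Y+q =
  +-cancelʳ-≡ q (X + d) Y (trans (+-assoc X d q) (trans (cong (X +_) d+q≡Z) X+Z≡Y+q))

module ThreeModFour (r : ℕ) where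
  open CyclicDevelopment (r + r)

  symmetricPair : Bool → ℕ → Point × Point
  symmetricPair l j = pt (suc j) l , pt (m ∸ suc j) l

  doublingPair : ℕ → Point × Point
  doublingPair j = pt (suc j) false , pt (suc j + suc j) true

  symmetricBase : Base
  symmetricBase = record
    { pairs    = map (symmetricPair false) (upTo r) ++ map (symmetricPair true) (upTo r)
    ; triangle = ∞ , pt 0 false , pt 0 true
    }

  doublingBase : Base
  doublingBase = record
    { pairs    = map doublingPair (upTo (r + r))
    ; triangle = ∞ , pt 0 true , pt 0 false
    }

  symmetricPair∈ : ∀ l j → j < r → symmetricPair l j ∈ pairs symmetricBase
  symmetricPair∈ false j j<r = ∈-++⁺ˡ (∈-map⁺ (symmetricPair false) (∈-upTo⁺ j<r))
  symmetricPair∈ true  j j<r =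
    ∈-++⁺ʳ (map (symmetricPair false) (upTo r)) (∈-map⁺ (symmetricPair true) (∈-upTo⁺ j<r))

  doublingPair∈ : ∀ j → j < r + r → doublingPair j ∈ pairs doublingBase
  doublingPair∈ j j<2r = ∈-map⁺ doublingPair (∈-upTo⁺ j<2r)

  symmetricBase-spans : IsSpanning symmetricBase
  symmetricBase-spans = record
    { pair-count    = trans (length-++ (map (symmetricPair false) (upTo r)))
                            (cong₂ _+_ (length-pairs false) (length-pairs true))
    ; every-residue = residue
    ; ∞-point       = triangle-point₁ symmetricBase refl
    }
    where
    length-pairs : ∀ l → length (map (symmetricPair l) (upTo r)) ≡ r
    length-pairs l = trans (length-map (symmetricPair l) (upTo r)) (length-upTo r)
    residue : ∀ l z → z < m → Σ ℕ λ a → pt a l ∈ basePoints symmetricBase × a ≡ₘ z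
    residue false zero _ = 0 , triangle-point₂ symmetricBase refl , ≡⇒≡ₘ refl
    residue true  zero _ = 0 , triangle-point₃ symmetricBase refl , ≡⇒≡ₘ refl
    residue l (suc j) _ with j <? r
    ... | yes j<r = suc j , pair-point₁ {symmetricBase} (symmetricPair∈ l j j<r) , ≡⇒≡ₘ refl
    residue l (suc j) 1+j<m | no j≮r with m≤n⇒∃[o]m+o≡n (≮⇒≥ j≮r)
    ... | t , refl with m≤n⇒∃[o]m+o≡n (+-cancelˡ-< r t r (s≤s⁻¹ 1+j<m))
    ...   | k , 1+t+k≡r =
      m ∸ suc k , pair-point₂ {symmetricBase} (symmetricPair∈ l k (subst (k <_) 1+t+k≡r (s≤s (m≤n+m k t)))) ,
      ≡⇒≡ₘ (mirror 1+t+k≡r)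
      where
      mirror : ∀ {r} → suc (t + k) ≡ r → suc (r + r) ∸ suc k ≡ suc (r + t)
      mirror refl = a≡c+b⇒a∸b≡c (by-ring t k)
        where
        by-ring : ∀ t k → suc (t + k) + suc (t + k) ≡ suc (suc (t + k) + t) + k
        by-ring = solve-∀

  doublingBase-spans : IsSpanning doublingBase
  doublingBase-spans = record
    { pair-count    = trans (length-map doublingPair (upTo (r + r))) (length-upTo (r + r))
    ; every-residue = residue
    ; ∞-point       = triangle-point₁ doublingBase refl
    }
    where
    residue : ∀ l z → z < m → Σ ℕ λ a → pt a l ∈ basePoints doublingBase × a ≡ₘ z
    residue false zero    _     = 0 , triangle-point₃ doublingBase refl , ≡⇒≡ₘ refl
    residue false (suc j) 1+j<m =
      suc j , pair-point₁ {doublingBase} (doublingPair∈ j (s≤s⁻¹ 1+j<m)) , ≡⇒≡ₘ refl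
    residue true  z       z<m with parity z
    ... | even zero    = 0 , triangle-point₂ doublingBase refl , ≡⇒≡ₘ refl
    ... | even (suc i) = suc i + suc i ,
                         pair-point₂ {doublingBase} (doublingPair∈ i i<2r) ,
                         ≡⇒≡ₘ refl
      where
      i<2r : i < r + r
      i<2r = <-≤-trans (n<1+n i) (≤-trans (m≤m+n (suc i) (suc i)) (s≤s⁻¹ z<m))
    ... | odd h        = suc (h + r) + suc (h + r) ,
                         pair-point₂ {doublingBase} (doublingPair∈ (h + r) (+-monoˡ-< r (h+h<k+k⇒h<k (s≤s⁻¹ z<m)))) ,
                         a≡b+m⇒a≡ₘb (by-ring h r)
      where
      by-ring : ∀ h r → suc (h + r) + suc (h + r) ≡ suc (h + h) + suc (r + r)
      by-ring = solve-∀

  bases : Bool → Base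
  bases false = symmetricBase
  bases true  = doublingBase

  same-level-difference : ∀ l d → d < m → ¬ d ≡ 0 → DifferenceCovered bases l l d
  same-level-difference l d d<m d≢0 with parity d
  ... | even zero    = ⊥-elim (d≢0 refl)
  ... | even (suc i) = false , m ∸ suc i , suc i ,
                       pair-arc-reversed {symmetricBase} (symmetricPair∈ l i i<r) ,
                       ≡ₘ-sym (m∸a+[a+a]≡ₘa (≤-trans (s≤s (<⇒≤ i<r)) (s≤s (m≤m+n r r))))
    where
    i<r : i < r
    i<r = h+h<k+k⇒h<k (<-≤-trans (+-mono-< (n<1+n i) (n<1+n i)) (s≤s⁻¹ d<m))
  ... | odd h with m≤n⇒∃[o]m+o≡n (h+h<k+k⇒h<k (s≤s⁻¹ d<m))
  ...   | k , 1+h+k≡r = false , suc k , m ∸ suc k ,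
                        pair-arc {symmetricBase} (symmetricPair∈ l k (subst (k <_) 1+h+k≡r (s≤s (m≤n+m k h)))) ,
                        ≡⇒≡ₘ (mirror (trans (+-suc h k) 1+h+k≡r))
    where
    mirror : ∀ {r} → h + suc k ≡ r → suc (r + r) ∸ suc k ≡ suc k + suc (h + h)
    mirror refl = a≡c+b⇒a∸b≡c (by-ring h k)
      where
      by-ring : ∀ h k → (h + suc k) + (h + suc k) ≡ (suc k + suc (h + h)) + k
      by-ring = solve-∀

  differences : ∀ l l′ d → d < m → (l ≡ l′ → ¬ d ≡ 0) → DifferenceCovered bases l l′ d
  differences false false d d<m d≢0 = same-level-difference false d d<m (d≢0 refl)
  differences true  true  d d<m d≢0 = same-level-difference true d d<m (d≢0 refl)
  differences false true  zero    _     _ = false , 0 , 0 , triangle-arc₂₃ symmetricBase refl , ≡⇒≡ₘ refl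
  differences false true  (suc j) 1+j<m _ =
    true , suc j , suc j + suc j , pair-arc {doublingBase} (doublingPair∈ j (s≤s⁻¹ 1+j<m)) , ≡⇒≡ₘ refl
  differences true  false zero    _     _ = true , 0 , 0 , triangle-arc₂₃ doublingBase refl , ≡⇒≡ₘ refl
  differences true  false (suc j) 1+j<m _ with m≤n⇒∃[o]m+o≡n (s≤s⁻¹ 1+j<m)
  ... | i , 1+j+i≡2r = true , suc i + suc i , suc i ,
                       pair-arc-reversed {doublingBase} (doublingPair∈ i (subst (i <_) 1+j+i≡2r (s≤s (m≤n+m i j)))) ,
                       ≡ₘ-sym (a≡b+m⇒a≡ₘb (wrap 1+j+i≡2r))
    where
    wrap : ∀ {R} → suc (j + i) ≡ R → (suc i + suc i) + suc j ≡ suc i + suc R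
    wrap refl = by-ring i j
      where
      by-ring : ∀ i j → (suc i + suc i) + suc j ≡ suc i + suc (suc (j + i))
      by-ring = solve-∀

  differenceFamily : DifferenceFamily
  differenceFamily = record
    { base        = bases
    ; spans       = λ { false → symmetricBase-spans ; true → doublingBase-spans }
    ; differences = differences
    ; from-∞      = λ { false → false , 0 , triangle-arc₁₂ symmetricBase refl
                      ; true  → true  , 0 , triangle-arc₁₂ doublingBase refl }
    ; to-∞        = λ { false → true  , 0 , triangle-arc₃₁ doublingBase refl
                      ; true  → false , 0 , triangle-arc₃₁ symmetricBase refl }
    }

factorization-3+4r : ∀ r → C2C3Factorization (3 + r * 4)
factorization-3+4r r = subst C2C3Factorization (by-ring r) (developedFactorization differenceFamily)
  where
  open ThreeModFour r
  open CyclicDevelopment (r + r)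
  by-ring : ∀ r → suc (suc (r + r) + suc (r + r)) ≡ 3 + r * 4
  by-ring = solve-∀

-- Arithmetic for m = 4q, q = p + 1.  The hypotheses are equations that are eliminated by
-- pattern matching, after which each claim is a ring identity; this is why q and m are
-- written out in terms of p rather than taken from the construction below.
symmetric-arc-span : ∀ p h j → suc (h + j) ≡ suc p + suc p →
  let q = suc p ; m = q + (q + q + q) in m ∸ suc j ≡ suc j + (h + h)
symmetric-arc-span p h j 1+h+j≡2q =
  a≡c+b⇒a∸b≡c (trans (by-ring₁ p) (trans (cong (λ x → x + x) (sym 1+h+j≡2q)) (by-ring₂ h j)))
  where
  by-ring₁ : ∀ p → suc p + (suc p + suc p + suc p) ≡ (suc p + suc p) + (suc p + suc p)
  by-ring₁ = solve-∀
  by-ring₂ : ∀ h j → suc (h + j) + suc (h + j) ≡ (suc j + (h + h)) + suc j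
  by-ring₂ = solve-∀

pair-sum-2q+1-span : ∀ p h i → h + i ≡ p → suc p + suc p ∸ i ≡ suc i + suc (h + h)
pair-sum-2q+1-span _ h i refl = a≡c+b⇒a∸b≡c (by-ring h i)
  where
  by-ring : ∀ h i → suc (h + i) + suc (h + i) ≡ (suc i + suc (h + h)) + i
  by-ring = solve-∀

pair-sum-2q-1-span : ∀ p h i → h + i ≡ p → suc p + suc p ∸ suc i ≡ i + suc (h + h)
pair-sum-2q-1-span _ h i refl = a≡c+b⇒a∸b≡c (by-ring h i)
  where
  by-ring : ∀ h i → suc (h + i) + suc (h + i) ≡ (i + suc (h + h)) + suc i
  by-ring = solve-∀

pair-sum-2q+1-reverse-span : ∀ p h t k → suc p + t ≡ h → t + k ≡ p →
  let q = suc p ; m = q + (q + q + q) in (q + q ∸ t) + suc (h + h) ≡ suc t + m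
pair-sum-2q+1-reverse-span _ _ t k refl refl =
  trans (cong (_+ suc ((suc (t + k) + t) + (suc (t + k) + t)))
              (a≡c+b⇒a∸b≡c {b = t} {c = suc (suc (t + k + k))} (by-ring₁ t k)))
        (by-ring₂ t k)
  where
  by-ring₁ : ∀ t k → suc (t + k) + suc (t + k) ≡ suc (suc (t + k + k)) + t
  by-ring₁ = solve-∀
  by-ring₂ : ∀ t k → let q = suc (t + k) ; h = q + t in
             suc (suc (t + k + k)) + suc (h + h) ≡ suc t + (q + (q + q + q))
  by-ring₂ = solve-∀

pair-sum-2q-1-reverse-span : ∀ p h t k → suc p + t ≡ h → t + k ≡ p →
  let q = suc p ; m = q + (q + q + q) in (q + q ∸ suc t) + suc (h + h) ≡ t + m
pair-sum-2q-1-reverse-span _ _ t k refl refl =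
  trans (cong (_+ suc ((suc (t + k) + t) + (suc (t + k) + t)))
              (a≡c+b⇒a∸b≡c {b = suc t} {c = t + k + suc k} (by-ring₁ t k)))
        (by-ring₂ t k)
  where
  by-ring₁ : ∀ t k → suc (t + k) + suc (t + k) ≡ (t + k + suc k) + suc t
  by-ring₁ = solve-∀
  by-ring₂ : ∀ t k → let q = suc (t + k) ; h = q + t in
             (t + k + suc k) + suc (h + h) ≡ t + (q + (q + q + q))
  by-ring₂ = solve-∀

cross-span-even-low : ∀ p t j d K → t + j ≡ p →
  let q = suc p ; q2 = q + q ; q3 = q2 + q ; m = q + q3 in
  d + q ≡ (t + t) + K * m → (q2 + suc j) + d ≡ (q3 ∸ suc j) + K * m
cross-span-even-low _ t j d K refl d+q≡ =
  trans (+-cancelʳ-via {X = suc (t + j) + suc (t + j) + suc j} d+q≡ (by-ring₂ t j K))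
        (cong (_+ (K * (q + (q + q + q))))
              (sym (a≡c+b⇒a∸b≡c {b = suc j} {c = suc (suc (t + t + t + j + j))} (by-ring₁ t j))))
  where
  q = suc (t + j)
  by-ring₁ : ∀ t j → let q = suc (t + j) in q + q + q ≡ (suc (suc (t + t + t + j + j))) + suc j
  by-ring₁ = solve-∀
  by-ring₂ : ∀ t j K → let q = suc (t + j) ; m = q + (q + q + q) in
             (q + q + suc j) + ((t + t) + K * m) ≡ (suc (suc (t + t + t + j + j)) + K * m) + q
  by-ring₂ = solve-∀

cross-span-even-high : ∀ p t u j d K → suc p + u ≡ t → u + j ≡ p →
  let q = suc p ; q2 = q + q ; q3 = q2 + q ; m = q + q3 in
  d + q ≡ (t + t) + K * m → (q3 + suc j) + d ≡ (q2 ∸ suc j) + suc K * m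
cross-span-even-high _ _ u j d K refl refl d+q≡ =
  trans (+-cancelʳ-via {X = q + q + q + suc j} d+q≡ (by-ring₂ u j K))
        (cong (_+ (suc K * (q + (q + q + q))))
              (sym (a≡c+b⇒a∸b≡c {b = suc j} {c = q + u} (by-ring₁ u j))))
  where
  q = suc (u + j)
  by-ring₁ : ∀ u j → let q = suc (u + j) in q + q ≡ (q + u) + suc j
  by-ring₁ = solve-∀
  by-ring₂ : ∀ u j K → let q = suc (u + j) ; m = q + (q + q + q) ; t = q + u in
             (q + q + q + suc j) + ((t + t) + K * m) ≡ ((q + u) + suc K * m) + q
  by-ring₂ = solve-∀

cross-span-odd-low : ∀ p t j d K → t + j ≡ p →
  let q = suc p ; q2 = q + q ; q3 = q2 + q ; m = q + q3 in
  d + q ≡ suc (t + t) + K * m → (q3 ∸ t) + d ≡ (q2 + suc t) + K * m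
cross-span-odd-low _ t j d K refl d+q≡ =
  trans (cong (_+ d) (a≡c+b⇒a∸b≡c {b = t} {c = q + q + suc j} (by-ring₁ t j)))
        (+-cancelʳ-via {X = q + q + suc j} d+q≡ (by-ring₂ t j K))
  where
  q = suc (t + j)
  by-ring₁ : ∀ t j → let q = suc (t + j) in q + q + q ≡ (q + q + suc j) + t
  by-ring₁ = solve-∀
  by-ring₂ : ∀ t j K → let q = suc (t + j) ; m = q + (q + q + q) in
             (q + q + suc j) + (suc (t + t) + K * m) ≡ ((q + q + suc t) + K * m) + q
  by-ring₂ = solve-∀

cross-span-odd-high : ∀ p t u j d K → suc p + u ≡ t → u + j ≡ p →
  let q = suc p ; q2 = q + q ; q3 = q2 + q ; m = q + q3 in
  d + q ≡ suc (t + t) + K * m → (q2 ∸ suc u) + d ≡ (q3 + u) + K * m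
cross-span-odd-high _ _ u j d K refl refl d+q≡ =
  trans (cong (_+ d) (a≡c+b⇒a∸b≡c {b = suc u} {c = q + j} (by-ring₁ u j)))
        (+-cancelʳ-via {X = q + j} d+q≡ (by-ring₂ u j K))
  where
  q = suc (u + j)
  by-ring₁ : ∀ u j → let q = suc (u + j) in q + q ≡ (q + j) + suc u
  by-ring₁ = solve-∀
  by-ring₂ : ∀ u j K → let q = suc (u + j) ; m = q + (q + q + q) ; t = q + u in
             (q + j) + (suc (t + t) + K * m) ≡ ((q + q + q + u) + K * m) + q
  by-ring₂ = solve-∀

module OneModEight (p : ℕ) where
  q : ℕ
  q = suc p

  q2 : ℕ
  q2 = q + q

  q3 : ℕ
  q3 = q2 + q

  open CyclicDevelopment (p + q3)

  m≡q3+q : m ≡ q3 + q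
  m≡q3+q = +-comm q q3

  m≡q2+q2 : m ≡ q2 + q2
  m≡q2+q2 = trans (cong (q +_) (+-comm q2 q)) (sym (+-assoc q q q2))

  symmetricPair : Bool → ℕ → Point × Point
  symmetricPair l j = pt (suc j) l , pt (m ∸ suc j) l

  otherLevelPair : Bool → ℕ → Point × Point
  otherLevelPair false i = pt i true , pt (q2 ∸ suc i) true
  otherLevelPair true  i = pt (suc i) false , pt (q2 ∸ i) false

  crossPartner₁ : Bool → ℕ → Point
  crossPartner₁ false j = pt (q3 ∸ suc j) true
  crossPartner₁ true  j = pt (q3 ∸ j) false

  crossPartner₂ : Bool → ℕ → Point
  crossPartner₂ false j = pt (q3 + j) true
  crossPartner₂ true  j = pt (q3 + suc j) false

  crossPair₁ : Bool → ℕ → Point × Point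
  crossPair₁ l j = pt (q2 + suc j) l , crossPartner₁ l j

  crossPair₂ : Bool → ℕ → Point × Point
  crossPair₂ l j = pt (q2 ∸ suc j) l , crossPartner₂ l j

  -- In base l, the symmetric pairs and the chord 0–2q of the triangle give the even differences
  -- within level l, the other-level pairs the odd differences within the other level, and the
  -- crossing pairs the mixed differences.
  base : Bool → Base
  base l = record
    { pairs    = map (symmetricPair l) (upTo p) ++ map (otherLevelPair l) (upTo q)
                 ++ map (crossPair₁ l) (upTo q) ++ map (crossPair₂ l) (upTo q)
    ; triangle = ∞ , pt 0 l , pt q2 l
    }

  symmetricPair∈ : ∀ l j → j < p → symmetricPair l j ∈ pairs (base l)
  symmetricPair∈ l j j<p = ∈-++⁺ˡ (∈-map⁺ (symmetricPair l) (∈-upTo⁺ j<p))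

  otherLevelPair∈ : ∀ l j → j < q → otherLevelPair l j ∈ pairs (base l)
  otherLevelPair∈ l j j<q = ∈-++⁺ʳ (map (symmetricPair l) (upTo p)) (∈-++⁺ˡ (∈-map⁺ (otherLevelPair l) (∈-upTo⁺ j<q)))

  crossPair₁∈ : ∀ l j → j < q → crossPair₁ l j ∈ pairs (base l)
  crossPair₁∈ l j j<q = ∈-++⁺ʳ (map (symmetricPair l) (upTo p)) (∈-++⁺ʳ (map (otherLevelPair l) (upTo q))
                          (∈-++⁺ˡ (∈-map⁺ (crossPair₁ l) (∈-upTo⁺ j<q))))

  crossPair₂∈ : ∀ l j → j < q → crossPair₂ l j ∈ pairs (base l)
  crossPair₂∈ l j j<q = ∈-++⁺ʳ (map (symmetricPair l) (upTo p)) (∈-++⁺ʳ (map (otherLevelPair l) (upTo q))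
                          (∈-++⁺ʳ (map (crossPair₁ l) (upTo q)) (∈-map⁺ (crossPair₂ l) (∈-upTo⁺ j<q))))

  length-pairs-base : ∀ l → length (pairs (base l)) ≡ p + q3
  length-pairs-base l = trans (length-++ (map (symmetricPair l) (upTo p)))
    (cong₂ _+_ (length-pairs (symmetricPair l) p) (trans (length-++ (map (otherLevelPair l) (upTo q)))
      (trans (cong₂ _+_ (length-pairs (otherLevelPair l) q)
                        (trans (length-++ (map (crossPair₁ l) (upTo q)))
                               (cong₂ _+_ (length-pairs (crossPair₁ l) q) (length-pairs (crossPair₂ l) q))))
             (sym (+-assoc q q q)))))
    where
    length-pairs : (f : ℕ → Point × Point) (k : ℕ) → length (map f (upTo k)) ≡ k
    length-pairs f k = trans (length-map f (upTo k)) (length-upTo k)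

  own-level-residue : ∀ l z → z < m → Σ ℕ λ a → pt a l ∈ basePoints (base l) × a ≡ₘ z
  own-level-residue l zero _ = 0 , triangle-point₂ (base l) refl , ≡⇒≡ₘ refl
  own-level-residue l (suc j) _ with j <? p
  ... | yes j<p = suc j , pair-point₁ {base l} (symmetricPair∈ l j j<p) , ≡⇒≡ₘ refl
  ... | no j≮p with suc j <? q2
  ...   | yes 1+j<2q with m≤n⇒∃[o]m+o≡n 1+j<2q
  ...     | k , e = q2 ∸ suc k ,
                    pair-point₁ {base l} (crossPair₂∈ l k (m+n≡o+p∧o<m⇒n<p {o = q} {p = q} e (s≤s (s≤s (≮⇒≥ j≮p))))) ,
                    ≡⇒≡ₘ (1+c+k≡a⇒a∸[1+k]≡c e)
  own-level-residue l (suc j) _   | no _ | no 1+j≮2q with suc j Data.Nat.≟ q2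
  ...     | yes 1+j≡2q = q2 , triangle-point₃ (base l) refl , ≡⇒≡ₘ (sym 1+j≡2q)
  ...     | no 1+j≢2q with suc j ≤? q3
  ...       | yes 1+j≤3q with m≤n⇒∃[o]m+o≡n (≤∧≢⇒< (≮⇒≥ 1+j≮2q) (1+j≢2q ∘ sym))
  ...         | k , e = q2 + suc k ,
                        pair-point₁ {base l} (crossPair₁∈ l k (+-cancelˡ-< q2 k q (subst (_≤ q2 + q) (sym e) 1+j≤3q))) ,
                        ≡⇒≡ₘ (trans (+-suc q2 k) e)
  own-level-residue l (suc j) 1+j<m | no _ | no _ | no _ | no 1+j≰3q with m≤n⇒∃[o]m+o≡n 1+j<m
  ...         | k , e = m ∸ suc k ,
                        pair-point₂ {base l} (symmetricPair∈ l k
                          (m+n≡o+p∧o<m⇒n<p {o = suc q3} {p = p} (trans e (cong suc (+-comm p q3))) (s≤s (≰⇒> 1+j≰3q)))) ,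
                        ≡⇒≡ₘ (1+c+k≡a⇒a∸[1+k]≡c e)

  base-false-residue-true : ∀ z → z < m → Σ ℕ λ a → pt a true ∈ basePoints (base false) × a ≡ₘ z
  base-false-residue-true z _ with z <? q
  ... | yes z<q = z , pair-point₁ {base false} (otherLevelPair∈ false z z<q) , ≡⇒≡ₘ refl
  ... | no z≮q with z <? q2
  ...   | yes z<2q with m≤n⇒∃[o]m+o≡n z<2q
  ...     | i , e = q2 ∸ suc i ,
                    pair-point₂ {base false} (otherLevelPair∈ false i (m+n≡o+p∧o<m⇒n<p {o = q} {p = q} e (s≤s (≮⇒≥ z≮q)))) ,
                    ≡⇒≡ₘ (1+c+k≡a⇒a∸[1+k]≡c e)
  base-false-residue-true z _   | no _ | no z≮2q with z <? q3
  ...     | yes z<3q with m≤n⇒∃[o]m+o≡n z<3q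
  ...       | j , e = q3 ∸ suc j ,
                      pair-point₂ {base false} (crossPair₁∈ false j (m+n≡o+p∧o<m⇒n<p {o = q2} {p = q} e (s≤s (≮⇒≥ z≮2q)))) ,
                      ≡⇒≡ₘ (1+c+k≡a⇒a∸[1+k]≡c e)
  base-false-residue-true z z<m | no _ | no _ | no z≮3q with m≤n⇒∃[o]m+o≡n (≮⇒≥ z≮3q)
  ...       | j , e = q3 + j ,
                      pair-point₂ {base false} (crossPair₂∈ false j (+-cancelˡ-< q3 j q (subst₂ _<_ (sym e) m≡q3+q z<m))) ,
                      ≡⇒≡ₘ e

  base-true-residue-false : ∀ z → z < m → Σ ℕ λ a → pt a false ∈ basePoints (base true) × a ≡ₘ z
  base-true-residue-false zero _ =
    q3 + suc p , pair-point₂ {base true} (crossPair₂∈ true p (n<1+n p)) , a≡b+m⇒a≡ₘb (sym m≡q3+q)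
  base-true-residue-false (suc i) _ with i <? q
  ... | yes i<q = suc i , pair-point₁ {base true} (otherLevelPair∈ true i i<q) , ≡⇒≡ₘ refl
  ... | no i≮q with suc i ≤? q2
  ...   | yes 1+i≤2q with m≤n⇒∃[o]m+o≡n 1+i≤2q
  ...     | k , e = q2 ∸ k ,
                    pair-point₂ {base true} (otherLevelPair∈ true k (m+n≡o+p∧o<m⇒n<p {o = q} {p = q} e (s≤s (≮⇒≥ i≮q)))) ,
                    ≡⇒≡ₘ (a≡c+b⇒a∸b≡c (sym e))
  base-true-residue-false (suc i) _ | no _ | no 1+i≰2q with suc i ≤? q3
  ...     | yes 1+i≤3q with m≤n⇒∃[o]m+o≡n 1+i≤3q
  ...       | j , e = q3 ∸ j ,
                      pair-point₂ {base true} (crossPair₁∈ true j (m+n≡o+p∧o<m⇒n<p {o = q2} {p = q} e (≰⇒> 1+i≰2q))) ,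
                      ≡⇒≡ₘ (a≡c+b⇒a∸b≡c (sym e))
  base-true-residue-false (suc i) 1+i<m | no _ | no _ | no 1+i≰3q with m≤n⇒∃[o]m+o≡n (≰⇒> 1+i≰3q)
  ...       | j , e = q3 + suc j ,
                      pair-point₂ {base true} (crossPair₂∈ true j
                        (+-cancelˡ-< q3 j q (subst₂ _≤_ (sym e) m≡q3+q (<⇒≤ 1+i<m)))) ,
                      ≡⇒≡ₘ (trans (+-suc q3 j) e)

  base-spans : ∀ b → IsSpanning (base b)
  base-spans b = record
    { pair-count    = length-pairs-base b
    ; every-residue = residue b
    ; ∞-point       = triangle-point₁ (base b) refl
    }
    where
    residue : ∀ b l z → z < m → Σ ℕ λ a → pt a l ∈ basePoints (base b) × a ≡ₘ z
    residue false false = own-level-residue false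
    residue true  true  = own-level-residue true
    residue false true  = base-false-residue-true
    residue true  false = base-true-residue-false

  h+h<m⇒h<2q : ∀ {h} → h + h < m → h < q2
  h+h<m⇒h<2q {h} h+h<m = h+h<k+k⇒h<k (subst (h + h <_) m≡q2+q2 h+h<m)

  even-same-level-difference : ∀ l j → suc j + suc j < m → DifferenceCovered base l l (suc j + suc j)
  even-same-level-difference l j _ with j <? p
  ... | yes j<p = l , m ∸ suc j , suc j , pair-arc-reversed {base l} (symmetricPair∈ l j j<p) ,
                  ≡ₘ-sym (m∸a+[a+a]≡ₘa (≤-trans (s≤s (<⇒≤ j<p)) (m≤m+n q q3)))
  ... | no j≮p with j Data.Nat.≟ p
  ...   | yes refl = l , 0 , q2 , triangle-arc₂₃ (base l) refl , ≡⇒≡ₘ refl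
  even-same-level-difference l j 2[1+j]<m | no j≮p | no j≢p with m≤n⇒∃[o]m+o≡n (h+h<m⇒h<2q 2[1+j]<m)
  ... | k , e = l , suc k , m ∸ suc k ,
                pair-arc {base l} (symmetricPair∈ l k
                  (m+n≡o+p∧o<m⇒n<p {o = suc q} {p = p} (trans e (cong suc (+-suc p p)))
                                    (s≤s (s≤s (≤∧≢⇒< (≮⇒≥ j≮p) (j≢p ∘ sym)))))) ,
                ≡⇒≡ₘ (symmetric-arc-span p (suc j) k e)

  odd-same-level-difference : ∀ l h → suc (h + h) < m → DifferenceCovered base l l (suc (h + h))
  odd-same-level-difference l h _ with h <? q
  odd-same-level-difference false h _ | yes h<q with m≤n⇒∃[o]m+o≡n h<q
  ... | i , e = true , suc i , q2 ∸ i ,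
                pair-arc {base true} (otherLevelPair∈ true i (subst (i <_) e (s≤s (m≤n+m i h)))) ,
                ≡⇒≡ₘ (pair-sum-2q+1-span p h i (suc-injective e))
  odd-same-level-difference true h _ | yes h<q with m≤n⇒∃[o]m+o≡n h<q
  ... | i , e = false , i , q2 ∸ suc i ,
                pair-arc {base false} (otherLevelPair∈ false i (subst (i <_) e (s≤s (m≤n+m i h)))) ,
                ≡⇒≡ₘ (pair-sum-2q-1-span p h i (suc-injective e))
  odd-same-level-difference l h 2h+1<m | no h≮q with m≤n⇒∃[o]m+o≡n (≮⇒≥ h≮q)
  ... | t , e₁
    with m≤n⇒∃[o]m+o≡n (+-cancelˡ-< q t q (subst (_< q2) (sym e₁) (h+h<m⇒h<2q (<-trans (n<1+n _) 2h+1<m))))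
  odd-same-level-difference false h _ | no _ | t , e₁ | k , e₂ =
    true , q2 ∸ t , suc t ,
    pair-arc-reversed {base true} (otherLevelPair∈ true t (subst (t <_) e₂ (s≤s (m≤m+n t k)))) ,
    ≡ₘ-sym (a≡b+m⇒a≡ₘb (pair-sum-2q+1-reverse-span p h t k e₁ (suc-injective e₂)))
  odd-same-level-difference true h _ | no _ | t , e₁ | k , e₂ =
    false , q2 ∸ suc t , t ,
    pair-arc-reversed {base false} (otherLevelPair∈ false t (subst (t <_) e₂ (s≤s (m≤m+n t k)))) ,
    ≡ₘ-sym (a≡b+m⇒a≡ₘb (pair-sum-2q-1-reverse-span p h t k e₁ (suc-injective e₂)))

  same-level-difference : ∀ l d → d < m → ¬ d ≡ 0 → DifferenceCovered base l l d
  same-level-difference l d d<m d≢0 with parity d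
  ... | even zero    = ⊥-elim (d≢0 refl)
  ... | even (suc j) = even-same-level-difference l j d<m
  ... | odd h        = odd-same-level-difference l h d<m

  CrossCovered : ℕ → Set
  CrossCovered d = Σ Bool λ b → Σ ℕ λ a → Σ ℕ λ a′ →
    (pt a false , pt a′ true) ∈ baseArcs (base b) × (pt a′ true , pt a false) ∈ baseArcs (base b) × a′ ≡ₘ a + d

  -- The crossing pairs realising d are chosen by e ≡ d + q (mod m): by its parity and whether e < 2q.
  cross-difference-via : ∀ d e K → d + q ≡ e + K * m → e < m → CrossCovered d
  cross-difference-via d e K d+q≡e+Km e<m with parity e
  ... | even t with t <? q
  ...   | yes t<q with m≤n⇒∃[o]m+o≡n t<q
  ...     | j , e′ = false , q2 + suc j , q3 ∸ suc j , pair-arc {base false} P∈ , pair-arc-reversed {base false} P∈ ,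
                     ≡ₘ-sym (a≡b+k*m⇒a≡ₘb K
                         (cross-span-even-low p t j d K (suc-injective e′) d+q≡e+Km))
    where
    P∈ = crossPair₁∈ false j (subst (j <_) e′ (s≤s (m≤n+m j t)))
  cross-difference-via d e K d+q≡e+Km e<m | even t | no t≮q with m≤n⇒∃[o]m+o≡n (≮⇒≥ t≮q)
  ...     | u , e₁ with m≤n⇒∃[o]m+o≡n (+-cancelˡ-< q u q (subst (_< q2) (sym e₁) (h+h<m⇒h<2q e<m)))
  ...       | j , e₂ = true , q3 + suc j , q2 ∸ suc j , pair-arc-reversed {base true} P∈ , pair-arc {base true} P∈ ,
                       ≡ₘ-sym (a≡b+k*m⇒a≡ₘb (suc K)
                         (cross-span-even-high p t u j d K e₁ (suc-injective e₂) d+q≡e+Km))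
    where
    P∈ = crossPair₂∈ true j (subst (j <_) e₂ (s≤s (m≤n+m j u)))
  cross-difference-via d e K d+q≡e+Km e<m | odd t with t <? q
  ...   | yes t<q with m≤n⇒∃[o]m+o≡n t<q
  ...     | j , e′ = true , q3 ∸ t , q2 + suc t , pair-arc-reversed {base true} P∈ , pair-arc {base true} P∈ ,
                     ≡ₘ-sym (a≡b+k*m⇒a≡ₘb K
                         (cross-span-odd-low p t j d K (suc-injective e′) d+q≡e+Km))
    where
    P∈ = crossPair₁∈ true t t<q
  cross-difference-via d e K d+q≡e+Km e<m | odd t | no t≮q with m≤n⇒∃[o]m+o≡n (≮⇒≥ t≮q)
  ...     | u , e₁
    with m≤n⇒∃[o]m+o≡n (+-cancelˡ-< q u q (subst (_< q2) (sym e₁) (h+h<m⇒h<2q (<-trans (n<1+n _) e<m))))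
  ...       | j , e₂ = false , q2 ∸ suc u , q3 + u , pair-arc {base false} P∈ , pair-arc-reversed {base false} P∈ ,
                       ≡ₘ-sym (a≡b+k*m⇒a≡ₘb K
                         (cross-span-odd-high p t u j d K e₁ (suc-injective e₂) d+q≡e+Km))
    where
    P∈ = crossPair₂∈ false u (subst (u <_) e₂ (s≤s (m≤m+n u j)))

  cross-difference : ∀ d → d < m → CrossCovered d
  cross-difference d d<m with d + q <? m
  ... | yes d+q<m = cross-difference-via d (d + q) 0 (sym (+-identityʳ (d + q))) d+q<m
  ... | no  d+q≮m = cross-difference-via d (d + q ∸ m) 1
                      (sym (trans (cong (d + q ∸ m +_) (+-identityʳ m)) (m∸n+n≡m m≤d+q))) d+q-m<m
    where
    m≤d+q : m ≤ d + q
    m≤d+q = ≮⇒≥ d+q≮m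
    d+q-m<m : d + q ∸ m < m
    d+q-m<m = +-cancelʳ-< m (d + q ∸ m) m
                (subst (_< m + m) (sym (m∸n+n≡m m≤d+q)) (+-mono-< d<m (m<m+n q {q3} (s≤s z≤n))))

  differences : ∀ l l′ d → d < m → (l ≡ l′ → ¬ d ≡ 0) → DifferenceCovered base l l′ d
  differences false false d d<m d≢0 = same-level-difference false d d<m (d≢0 refl)
  differences true  true  d d<m d≢0 = same-level-difference true d d<m (d≢0 refl)
  differences false true  d d<m _ with cross-difference d d<m
  ... | b , a , a′ , aa′∈B , _ , a′≡a+d = b , a , a′ , aa′∈B , a′≡a+d
  differences true  false d d<m _ with cross-difference ((m ∸ d) % m) (m%n<n (m ∸ d) m)
  ... | b , a , a′ , _ , a′a∈B , a′≡a-d = b , a′ , a , a′a∈B , ≡ₘ-sym a′+d≡a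
    where
    open SetoidReasoning ≡ₘ-setoid
    a′+d≡a : a′ + d ≡ₘ a
    a′+d≡a = begin
      a′ + d                    ≈⟨ +-congʳ-≡ₘ d a′≡a-d ⟩
      a + (m ∸ d) % m + d       ≡⟨ +-assoc a ((m ∸ d) % m) d ⟩
      a + ((m ∸ d) % m + d)     ≈⟨ +-congˡ-≡ₘ a (+-congʳ-≡ₘ d (a%m≡ₘa (m ∸ d))) ⟩
      a + (m ∸ d + d)           ≡⟨ cong (a +_) (m∸n+n≡m (<⇒≤ d<m)) ⟩
      a + m                     ≈⟨ a+m≡ₘa a ⟩
      a                         ∎

  differenceFamily : DifferenceFamily
  differenceFamily = record
    { base        = base
    ; spans       = base-spans
    ; differences = differences
    ; from-∞      = λ l → l , 0 , triangle-arc₁₂ (base l) refl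
    ; to-∞        = λ l → l , q2 , triangle-arc₃₁ (base l) refl
    }

factorization-9+8p : ∀ p → C2C3Factorization (9 + p * 8)
factorization-9+8p p = subst C2C3Factorization (by-ring p) (developedFactorization differenceFamily)
  where
  open OneModEight p
  open CyclicDevelopment (p + q3)
  by-ring : ∀ p → let q = suc p ; m = suc (p + (q + q + q)) in suc (m + m) ≡ 9 + p * 8
  by-ring = solve-∀

factorization-by-residue : ∀ r k → 5 ≤ r + k * 8 → (r ≡ 1 ⊎ r ≡ 3 ⊎ r ≡ 7) → C2C3Factorization (r + k * 8)
factorization-by-residue _ zero    (s≤s ()) (inj₁ refl)
factorization-by-residue _ (suc p) _        (inj₁ refl)        = factorization-9+8p p
factorization-by-residue _ k       _        (inj₂ (inj₁ refl)) =
  subst C2C3Factorization (by-ring k) (factorization-3+4r (k + k))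
  where
  by-ring : ∀ k → 3 + (k + k) * 4 ≡ 3 + k * 8
  by-ring = solve-∀
factorization-by-residue _ k       _        (inj₂ (inj₂ refl)) =
  subst C2C3Factorization (by-ring k) (factorization-3+4r (suc (k + k)))
  where
  by-ring : ∀ k → 3 + suc (k + k) * 4 ≡ 7 + k * 8
  by-ring = solve-∀

theorem3p9 : (n : ℕ) → 5 ≤ n → (n % 8 ≡ 1 ⊎ n % 8 ≡ 3 ⊎ n % 8 ≡ 7) → C2C3Factorization n
theorem3p9 n 5≤n n%8∈137 =
  subst C2C3Factorization (sym n≡n%8+[n/8]*8)
        (factorization-by-residue (n % 8) (n / 8) (subst (5 ≤_) n≡n%8+[n/8]*8 5≤n) n%8∈137)
  where
  n≡n%8+[n/8]*8 : n ≡ n % 8 + (n / 8) * 8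
  n≡n%8+[n/8]*8 = m≡m%n+[m/n]*n n 8
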